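{- Let $b > 2$ and $k > 2$ be integers and let $d \in \{1, \dots, b-1\}$. There exists a smallest finite set $U(b,d)$ of integers with the following property: if a base-$b$ generalized comma sequence (with any positive initial value) has a term in the interval $[d\, b^k - b^2,\ d\, b^k)$, then its last term in this interval equals $d\, b^k - u$ for some $u \in U(b,d)$. Moreover, writing $(r,s)_b = rb + s$ for digits $r, s \in \{0,\dots,b-1\}$: if $d \ne 1$, then \[ U(b,d) = \{(r,s)_b : r + s < b,\ 0 < s < b\} \cup \{(r,s)_b : r + s = b,\ s < d\}; \] if $d = 1$, then \[ U(b,1) = \{(r,s)_b : r + s \le b,\ 0 < s < b\}. \]
   Context: For an integer base $b \ge 2$ and a positive integer $v$, the generalized comma sequence in base $b$ with initial value $v$ is the sequence $a(1), a(2), \dots$ with $a(1) = v$ and, for $n > 1$: if $x$ is the least significant base-$b$ digit of $a(n-1)$, then $a(n) = a(n-1) + bx + y$, where $y \in \{0,\dots,b-1\}$ must equal the most significant base-$b$ digit of $a(n)$ and is the smallest digit with this property; if no such $y$ exists, the sequence terminates at $a(n-1)$. -}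

module Defs where

open import Data.Nat using (ℕ; zero; suc; _+_; _*_; _^_; _≤_; _<_; _<ᵇ_; _≡ᵇ_; NonZero)
open import Data.Nat.DivMod using (_/_; _%_)
open import Data.Bool using (if_then_else_)
open import Data.List using (List; []; _∷_; upTo)
open import Data.Maybe using (Maybe; just; nothing; _>>=_)
open import Data.Product using (Σ; ∃; _×_; _,_)
open import Data.Sum using (_⊎_)
open import Relation.Binary.PropositionalEquality using (_≡_)
open import Relation.Nullary using (¬_)

-- Most significant base-b digit of n (fuel-based; fuel n suffices since b ≥ 2).
msdAux : (b : ℕ) → .{{NonZero b}} → ℕ → ℕ → ℕ
msdAux b zero    n = n
msdAux b (suc f) n = if n <ᵇ b then n else msdAux b f (n / b)

msd : (b : ℕ) → .{{NonZero b}} → ℕ → ℕ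
msd b n = msdAux b n n

searchY : (b : ℕ) → .{{NonZero b}} → ℕ → List ℕ → Maybe ℕ
searchY b a []       = nothing
searchY b a (y ∷ ys) =
  let c = a + b * (a % b) + y in
  if msd b c ≡ᵇ y then just c else searchY b a ys

commaStep : (b : ℕ) → .{{NonZero b}} → ℕ → Maybe ℕ
commaStep b a = searchY b a (upTo b)

-- comma b v n = a(n+1) (0-indexed), or nothing if the sequence has terminated.
comma : (b : ℕ) → .{{NonZero b}} → ℕ → ℕ → Maybe ℕ
comma b v zero    = just v
comma b v (suc n) = comma b v n >>= commaStep b

InInterval : ℕ → ℕ → ℕ → ℕ → Set
InInterval b k d a = (d * b ^ k ≤ a + b ^ 2) × (a < d * b ^ k)

HasProperty : (b : ℕ) → .{{NonZero b}} → ℕ → ℕ → (ℕ → Set) → Set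
HasProperty b k d U =
  ∀ v → 0 < v →
  (∃ λ n → ∃ λ a → comma b v n ≡ just a × InInterval b k d a) →
  ∃ λ n → ∃ λ a → comma b v n ≡ just a × InInterval b k d a ×
    (∀ m a′ → n < m → comma b v m ≡ just a′ → ¬ InInterval b k d a′) ×
    (∃ λ u → U u × a + u ≡ d * b ^ k)

Uexplicit : ℕ → ℕ → ℕ → Set
Uexplicit b (suc zero) u =
  ∃ λ r → ∃ λ s → r < b × s < b × u ≡ r * b + s ×
    (r + s ≤ b × 0 < s)
Uexplicit b d u =
  ∃ λ r → ∃ λ s → r < b × s < b × u ≡ r * b + s ×
    ((r + s < b × 0 < s) ⊎ (r + s ≡ b × s < d))

-- Every number in [d b^k - b^2, d b^k) has the same leading digit D, namely d - 1, or b - 1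
-- when d = 1 (this is where k > 2 is needed).  So from a term a of this interval, with last
-- digit x, a candidate a + b x + y below d b^k qualifies only for y = D: the sequence moves on
-- to a + b x + D if that is still below d b^k, and otherwise jumps to d b^k or beyond.  Hence a
-- is the last term in the interval exactly when u = d b^k - a satisfies u <= b x + D.  As b
-- divides d b^k, the last digit s of u satisfies x + s ∈ {0, b}, and writing u = (r,s)_b the
-- bound becomes the digit condition defining U(b,d).  Minimality: the sequence started at
-- d b^k - u, for u ∈ U(b,d), leaves the interval after its first term.
module Submission where

open import Data.Bool using (T; true; false)
open import Data.List using ([]; _∷_; _++_; [_]; _∷ʳ_; upTo)
open import Data.List.Properties using (++-assoc; ++-identityʳ; upTo-∷ʳ)
open import Data.List.Relation.Unary.All using (All; []; _∷_)
open import Data.List.Relation.Unary.All.Properties using (applyUpTo⁺₁)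
open import Data.Maybe using (just)
open import Data.Maybe.Properties using (just-injective)
open import Data.Nat
open import Data.Nat.DivMod
open import Data.Nat.Divisibility using (_∣_; m%n≡0⇒n∣m; n∣m⇒m%n≡0; ∣⇒≤; m∣m*n; ∣n⇒∣m*n)
open import Data.Nat.Induction using (<-wellFounded)
open import Data.Nat.Properties
open import Data.Product using (∃; ∃₂; _×_; _,_; proj₂)
open import Data.Sum using (_⊎_; inj₁; inj₂; map₂)
open import Function.Base using (_∘_)
open import Function.Bundles using (_⇔_; mk⇔; Equivalence)
open import Function.Construct.Composition using (_⇔-∘_)
open import Function.Construct.Symmetry using (⇔-sym)
open import Induction.WellFounded using (Acc; acc)
open import Relation.Binary using (tri<; tri≈; tri>)
open import Relation.Binary.PropositionalEquality using (_≡_; refl; sym; trans; cong; subst; module ≡-Reasoning)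
open import Relation.Nullary using (¬_; contradiction; yes; no)

open import Defs

module _ {b : ℕ} .{{_ : NonZero b}} (1<b : 1 < b) where

  private
    shift-power : ∀ D j → D * (b * b ^ j) ≡ D * b ^ j * b
    shift-power D j = trans (cong (D *_) (*-comm b (b ^ j))) (sym (*-assoc D (b ^ j) b))

    base≤ : ∀ {D c} j → 0 < D → D * (b * b ^ j) ≤ c → b ≤ c
    base≤ {D} j 0<D lo = ≤-trans (m≤m*n b (b ^ j) {{>-nonZero (m^n>0 b j)}})
                                 (≤-trans (m≤n*m (b * b ^ j) D {{>-nonZero 0<D}}) lo)

  msdAux-digit : ∀ j {D c} f → 0 < D → D < b →
                 D * b ^ j ≤ c → c < suc D * b ^ j → c ≤ f → msdAux b f c ≡ D
  msdAux-digit zero {D} {c} f _ D<b lo hi _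
    with ≤-antisym (≤-pred (subst (c <_) (*-identityʳ (suc D)) hi)) (subst (_≤ c) (*-identityʳ D) lo)
  ... | refl with f
  ...   | zero  = refl
  ...   | suc _ with D <ᵇ b in D<ᵇb
  ...     | true  = refl
  ...     | false = contradiction (<⇒<ᵇ D<b) (subst T D<ᵇb)
  msdAux-digit (suc j) {D} {c} zero 0<D D<b lo hi c≤0 =
    contradiction (≤-trans (base≤ j 0<D lo) c≤0) (<⇒≱ (<-trans z<s 1<b))
  msdAux-digit (suc j) {D} {c} (suc f′) 0<D D<b lo hi c≤f with c <ᵇ b in c<ᵇb
  ... | true  = contradiction (<ᵇ⇒< c b (subst T (sym c<ᵇb) _)) (≤⇒≯ (base≤ j 0<D lo))
  ... | false = msdAux-digit j f′ 0<D D<b lo′ hi′ c/b≤f′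
    where
    instance _ = >-nonZero (m^n>0 b j)
    lo′ : D * b ^ j ≤ c / b
    lo′ = subst (_≤ c / b) (m*n/n≡m (D * b ^ j) b) (/-monoˡ-≤ b (subst (_≤ c) (shift-power D j) lo))
    hi′ : c / b < suc D * b ^ j
    hi′ = m<n*o⇒m/o<n (subst (c <_) (shift-power (suc D) j) hi)
    c/b≤f′ : c / b ≤ f′
    c/b≤f′ = ≤-pred (<-≤-trans (m/n<m c b {{>-nonZero (<-≤-trans (<-trans z<s 1<b) (base≤ j 0<D lo))}} 1<b) c≤f)

lowerDigit : ℕ → ℕ → ℕ
lowerDigit b (suc (suc d)) = suc d
lowerDigit b _             = pred b

lowerDigit<b : ∀ {b d} → d < b → lowerDigit b d < b
lowerDigit<b {b}     {suc (suc d)} d<b = <-trans (n<1+n _) d<b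
lowerDigit<b {suc b} {zero}        _   = n<1+n b
lowerDigit<b {suc b} {suc zero}    _   = n<1+n b

lowerDigit>0 : ∀ {b} d → 1 < b → 0 < lowerDigit b d
lowerDigit>0         (suc (suc d)) _          = z<s
lowerDigit>0 {suc b} zero          (s≤s 0<b) = 0<b
lowerDigit>0 {suc b} (suc zero)    (s≤s 0<b) = 0<b

msd-justBelow : ∀ {b} .{{_ : NonZero b}} {k d c} → 1 < b → 2 < k → 0 < d → d < b →
            d * b ^ k ≤ c + b ^ 2 → c < d * b ^ k → msd b c ≡ lowerDigit b d
msd-justBelow {b} {k} {suc (suc d)} {c} 1<b 2<k _ d<b lo hi =
  msdAux-digit 1<b k c z<s (<-trans (n<1+n _) d<b) lo′ hi ≤-refl
  where
  lo′ : suc d * b ^ k ≤ c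
  lo′ = +-cancelʳ-≤ (b ^ k) _ c
          (≤-trans (≤-reflexive (+-comm (suc d * b ^ k) (b ^ k)))
          (≤-trans lo (+-monoʳ-≤ c (^-monoʳ-≤ b (<⇒≤ 2<k)))))
msd-justBelow {suc b} {suc k} {suc zero} {c} 1<b (s≤s 1<k) _ _ lo hi =
  msdAux-digit 1<b k c (≤-pred 1<b) ≤-refl lo′ (subst (c <_) (+-identityʳ _) hi) ≤-refl
  where
  lo′ : b * suc b ^ k ≤ c
  lo′ = +-cancelʳ-≤ (suc b ^ k) _ c
          (≤-trans (≤-reflexive (trans (+-comm (b * suc b ^ k) _) (sym (+-identityʳ _))))
          (≤-trans lo (+-monoʳ-≤ c (^-monoʳ-≤ (suc b) 1<k))))

upTo-+ : ∀ m n → ∃ λ zs → upTo (m + n) ≡ upTo m ++ zs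
upTo-+ m zero = [] , trans (cong upTo (+-identityʳ m)) (sym (++-identityʳ (upTo m)))
upTo-+ m (suc n) with upTo-+ m n
... | zs , eq = zs ∷ʳ (m + n) , (begin
  upTo (m + suc n)          ≡⟨ cong upTo (+-suc m n) ⟩
  upTo (suc (m + n))        ≡⟨ upTo-∷ʳ (m + n) ⟨
  upTo (m + n) ∷ʳ (m + n)   ≡⟨ cong (_∷ʳ (m + n)) eq ⟩
  (upTo m ++ zs) ∷ʳ (m + n) ≡⟨ ++-assoc (upTo m) zs [ m + n ] ⟩
  upTo m ++ zs ∷ʳ (m + n) ∎)
  where open ≡-Reasoning

module _ (b : ℕ) .{{_ : NonZero b}} where

  candidate : ℕ → ℕ → ℕ
  candidate a y = a + b * (a % b) + y

  Qualifies : ℕ → ℕ → Set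
  Qualifies a y = msd b (candidate a y) ≡ y

  searchY-sound : ∀ ys {a c} → searchY b a ys ≡ just c → ∃ λ y → Qualifies a y × c ≡ candidate a y
  searchY-sound (y ∷ ys) {a} eq with msd b (candidate a y) ≡ᵇ y in q
  ... | true  = y , ≡ᵇ⇒≡ _ _ (subst T (sym q) _) , sym (just-injective eq)
  ... | false = searchY-sound ys eq

  searchY-++-skip : ∀ {a xs} ys → All (λ y → ¬ Qualifies a y) xs → searchY b a (xs ++ ys) ≡ searchY b a ys
  searchY-++-skip ys [] = refl
  searchY-++-skip {a} {y ∷ xs} ys (¬q ∷ ¬qs) with msd b (candidate a y) ≡ᵇ y in q
  ... | true  = contradiction (≡ᵇ⇒≡ _ _ (subst T (sym q) _)) ¬q
  ... | false = searchY-++-skip ys ¬qs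

  searchY-hit : ∀ {a y} ys → Qualifies a y → searchY b a (y ∷ ys) ≡ just (candidate a y)
  searchY-hit {a} {y} ys q with msd b (candidate a y) ≡ᵇ y in q′
  ... | true  = refl
  ... | false = contradiction (subst T q′ (≡⇒≡ᵇ _ _ q)) λ ()

  commaStep-sound : ∀ {a c} → commaStep b a ≡ just c → ∃ λ y → Qualifies a y × c ≡ candidate a y
  commaStep-sound = searchY-sound (upTo b)

  commaStep-first : ∀ {a y} → y < b → (∀ {z} → z < y → ¬ Qualifies a z) → Qualifies a y →
                    commaStep b a ≡ just (candidate a y)
  commaStep-first {a} {y} y<b earlier q with upTo-+ (suc y) (b ∸ suc y)
  ... | zs , eq = begin
    searchY b a (upTo b)                    ≡⟨ cong (searchY b a) (trans (cong upTo (sym (m+[n∸m]≡n y<b))) eq) ⟩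
    searchY b a (upTo (suc y) ++ zs)        ≡⟨ cong (λ ys → searchY b a (ys ++ zs)) (sym (upTo-∷ʳ y)) ⟩
    searchY b a ((upTo y ∷ʳ y) ++ zs)       ≡⟨ cong (searchY b a) (++-assoc (upTo y) [ y ] zs) ⟩
    searchY b a (upTo y ++ y ∷ zs)          ≡⟨ searchY-++-skip (y ∷ zs) (applyUpTo⁺₁ _ y earlier) ⟩
    searchY b a (y ∷ zs)                    ≡⟨ searchY-hit zs q ⟩
    just (candidate a y)                    ∎
    where open ≡-Reasoning

  candidate-≥ : ∀ a y → a ≤ candidate a y
  candidate-≥ a y = ≤-trans (m≤m+n a (b * (a % b))) (m≤m+n _ y)

  commaStep-≥ : ∀ {a c} → commaStep b a ≡ just c → a ≤ c
  commaStep-≥ {a} st with commaStep-sound st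
  ... | y , _ , refl = candidate-≥ a y

  comma-successor-≤-later : ∀ {v n m a a′} → comma b v n ≡ just a → n < m → comma b v m ≡ just a′ →
                            ∃ λ c → commaStep b a ≡ just c × c ≤ a′
  comma-successor-≤-later {v} {n} {suc m} {a} {a′} eqn (s≤s n≤m) eqm with m≤n⇒m<n∨m≡n n≤m
  ... | inj₂ refl rewrite eqn = a′ , eqm , ≤-refl
  ... | inj₁ n<m with comma b v m in eq
  ...   | just a″ with comma-successor-≤-later eqn n<m eq
  ...     | c , st , c≤a″ = c , st , ≤-trans c≤a″ (commaStep-≥ eqm)

digitSum-divisible : ∀ {b} .{{_ : NonZero b}} {x s} → x < b → s < b →
                     (x + s) % b ≡ 0 → x + s ≡ 0 ⊎ x + s ≡ b
digitSum-divisible {b} {x} {s} x<b s<b x+s%b≡0 with x + s <? b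
... | yes x+s<b = inj₁ (trans (sym (m<n⇒m%n≡m x+s<b)) x+s%b≡0)
... | no  x+s≮b = inj₂ (begin
  x + s      ≡⟨ m∸n+n≡m b≤x+s ⟨
  t + b      ≡⟨ cong (_+ b) t≡0 ⟩
  b          ∎)
  where
  open ≡-Reasoning
  b≤x+s = ≮⇒≥ x+s≮b
  t = x + s ∸ b
  t<b : t < b
  t<b = +-cancelʳ-< b t b (subst (_< b + b) (sym (m∸n+n≡m b≤x+s)) (+-mono-< x<b s<b))
  t≡0 : t ≡ 0
  t≡0 = begin
    t            ≡⟨ m<n⇒m%n≡m t<b ⟨
    t % b        ≡⟨ [m+n]%n≡m%n t b ⟨
    (t + b) % b  ≡⟨ cong (_% b) (m∸n+n≡m b≤x+s) ⟩
    (x + s) % b  ≡⟨ x+s%b≡0 ⟩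
    0            ∎

digits-< : ∀ {b r x s} → r < x → s < b → r * b + s < x * b
digits-< {b} {r} {x} {s} r<x s<b = begin-strict
  r * b + s  <⟨ +-monoʳ-< (r * b) s<b ⟩
  r * b + b  ≡⟨ +-comm (r * b) b ⟩
  suc r * b  ≤⟨ *-monoˡ-≤ b r<x ⟩
  x * b      ∎
  where open ≤-Reasoning

m+n≤o⇒m<o : ∀ {m n o} → 0 < n → m + n ≤ o → m < o
m+n≤o⇒m<o {m} 0<n m+n≤o = <-≤-trans (m<m+n m 0<n) m+n≤o

complement-pos : ∀ {b x s} → x < b → x + s ≡ b → 0 < s
complement-pos {x = x} {s = zero}  x<b x+0≡b = contradiction (trans (sym (+-identityʳ x)) x+0≡b) (<⇒≢ x<b)
complement-pos {s = suc s} _   _       = z<s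

digits-% : ∀ {b} .{{_ : NonZero b}} r {s} → s < b → (r * b + s) % b ≡ s
digits-% {b} r {s} s<b = trans (cong (_% b) (+-comm (r * b) s)) (trans ([m+kn]%n≡m%n s r b) (m<n⇒m%n≡m s<b))

-- (r,s)_b ∈ U(b,d) in a form uniform in d, with D = lowerDigit b d: for d ≥ 2 the condition
-- s < d reads s ≤ D, and for d = 1 the condition s ≤ D = b - 1 is automatic.
UDigits : ℕ → ℕ → ℕ → ℕ → Set
UDigits b D r s = 0 < s × (r + s < b ⊎ (r + s ≡ b × s ≤ D))

UDigits⇒sum≤ : ∀ {b D r s} → UDigits b D r s → r + s ≤ b
UDigits⇒sum≤ (_ , inj₁ r+s<b)       = <⇒≤ r+s<b
UDigits⇒sum≤ (_ , inj₂ (r+s≡b , _)) = ≤-reflexive r+s≡b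

Uexplicit-elim : ∀ {b d u} → 0 < d → Uexplicit b d u →
                 ∃₂ λ r s → s < b × u ≡ r * b + s × UDigits b (lowerDigit b d) r s
Uexplicit-elim {b} {suc zero} _ (r , s , _ , s<b , u≡ , r+s≤b , 0<s) =
  r , s , s<b , u≡ , 0<s , map₂ (_, <⇒≤pred s<b) (m≤n⇒m<n∨m≡n r+s≤b)
Uexplicit-elim {b} {suc (suc d)} _ (r , s , _ , s<b , u≡ , inj₁ (r+s<b , 0<s)) =
  r , s , s<b , u≡ , 0<s , inj₁ r+s<b
Uexplicit-elim {b} {suc (suc d)} _ (r , s , r<b , s<b , u≡ , inj₂ (r+s≡b , s<d)) =
  r , s , s<b , u≡ , complement-pos r<b r+s≡b , inj₂ (r+s≡b , ≤-pred s<d)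

Uexplicit-intro : ∀ {b d r s} → 0 < d → s < b → UDigits b (lowerDigit b d) r s → Uexplicit b d (r * b + s)
Uexplicit-intro {b} {suc zero} {r} {s} _ s<b digits@(0<s , _) =
  r , s , m+n≤o⇒m<o 0<s (UDigits⇒sum≤ digits) , s<b , refl , UDigits⇒sum≤ digits , 0<s
Uexplicit-intro {b} {suc (suc d)} {r} {s} _ s<b (0<s , inj₁ r+s<b) =
  r , s , ≤-<-trans (m≤m+n r s) r+s<b , s<b , refl , inj₁ (r+s<b , 0<s)
Uexplicit-intro {b} {suc (suc d)} {r} {s} _ s<b (0<s , inj₂ (r+s≡b , s≤D)) =
  r , s , m+n≤o⇒m<o 0<s (≤-reflexive r+s≡b) , s<b , refl , inj₂ (r+s≡b , s≤s s≤D)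

UDigits⇒exitBound : ∀ {b D x r s} → x + s ≡ b → UDigits b D r s → r * b + s ≤ b * x + D
UDigits⇒exitBound {b} {D} {x} {r} {s} x+s≡b (_ , inj₁ r+s<b) = begin
  r * b + s  <⟨ digits-< r<x (≤-<-trans (m≤n+m s r) r+s<b) ⟩
  x * b      ≡⟨ *-comm x b ⟩
  b * x      ≤⟨ m≤m+n (b * x) D ⟩
  b * x + D  ∎
  where
  open ≤-Reasoning
  r<x : r < x
  r<x = +-cancelʳ-< s r x (subst (r + s <_) (sym x+s≡b) r+s<b)
UDigits⇒exitBound {b} {D} {x} {r} {s} x+s≡b (_ , inj₂ (r+s≡b , s≤D))
  with +-cancelʳ-≡ s r x (trans r+s≡b (sym x+s≡b))
... | refl = subst (λ y → r * b + s ≤ y + D) (*-comm r b) (+-monoʳ-≤ (r * b) s≤D)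

exitBound⇒UDigits : ∀ {b D x r s} → x < b → D < b → x + s ≡ b → r * b + s ≤ b * x + D → UDigits b D r s
exitBound⇒UDigits {b} {D} {x} {r} {s} x<b D<b x+s≡b bound with <-cmp r x
... | tri< r<x _ _ = complement-pos x<b x+s≡b , inj₁ (subst (r + s <_) x+s≡b (+-monoˡ-< s r<x))
... | tri≈ _ refl _ = complement-pos x<b x+s≡b ,
      inj₂ (x+s≡b , +-cancelˡ-≤ (r * b) s D (subst (λ y → r * b + s ≤ y + D) (*-comm b r) bound))
... | tri> _ _ x<r = contradiction bound (<⇒≱ (begin-strict
  b * x + D  ≡⟨ cong (_+ D) (*-comm b x) ⟩
  x * b + D  <⟨ digits-< x<r D<b ⟩
  r * b      ≤⟨ m≤m+n (r * b) s ⟩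
  r * b + s  ∎))
  where open ≤-Reasoning

-- x is the last digit of a term a of the interval and u = d b^k - a, so b divides a + u.
Uexplicit⇔exitBound : ∀ {b d x u} .{{_ : NonZero b}} → 0 < d → d < b → x < b → 0 < u →
                      x + u % b ≡ 0 ⊎ x + u % b ≡ b → Uexplicit b d u ⇔ u ≤ b * x + lowerDigit b d
Uexplicit⇔exitBound {b} {d} {x} {u} 0<d d<b x<b 0<u lastDigits = mk⇔ to (from lastDigits)
  where
  D = lowerDigit b d
  to : Uexplicit b d u → u ≤ b * x + D
  to U with Uexplicit-elim 0<d U
  ... | r , s , s<b , refl , digits@(0<s , _) with subst (λ t → x + t ≡ 0 ⊎ x + t ≡ b) (digits-% r s<b) lastDigits
  ...   | inj₁ x+s≡0 = contradiction (m+n≡0⇒n≡0 x x+s≡0) (>⇒≢ 0<s)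
  ...   | inj₂ x+s≡b = UDigits⇒exitBound x+s≡b digits
  from : x + u % b ≡ 0 ⊎ x + u % b ≡ b → u ≤ b * x + D → Uexplicit b d u
  from (inj₁ x+u%b≡0) bound = contradiction (≤-trans b≤u u≤D) (<⇒≱ (lowerDigit<b d<b))
    where
    b≤u : b ≤ u
    b≤u = ∣⇒≤ {{>-nonZero 0<u}} (m%n≡0⇒n∣m u b (m+n≡0⇒n≡0 x x+u%b≡0))
    u≤D : u ≤ D
    u≤D = subst (λ y → u ≤ y + D) (*-zeroʳ b) (subst (λ y → u ≤ b * y + D) (m+n≡0⇒m≡0 x x+u%b≡0) bound)
  from (inj₂ x+u%b≡b) bound = subst (Uexplicit b d) (sym u≡digits)
    (Uexplicit-intro {r = u / b} 0<d (m%n<n u b)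
      (exitBound⇒UDigits {r = u / b} x<b (lowerDigit<b d<b) x+u%b≡b (subst (_≤ b * x + D) u≡digits bound)))
    where
    u≡digits : u ≡ u / b * b + u % b
    u≡digits = trans (m≡m%n+[m/n]*n u b) (+-comm (u % b) _)

n∣m*n^o : ∀ m n o → 0 < o → n ∣ m * n ^ o
n∣m*n^o m n (suc o) _ = ∣n⇒∣m*n m (m∣m*n (n ^ o))

lastDigits-complement : ∀ {b} .{{_ : NonZero b}} a u → b ∣ a + u → a % b + u % b ≡ 0 ⊎ a % b + u % b ≡ b
lastDigits-complement {b} a u b∣a+u = digitSum-divisible (m%n<n a b) (m%n<n u b)
  (trans (sym (%-distribˡ-+ a u b)) (n∣m⇒m%n≡0 (a + u) b b∣a+u))

Uexplicit-bounds : ∀ {b d u} → 0 < d → Uexplicit b d u → 0 < u × u < b ^ 2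
Uexplicit-bounds {b} 0<d U with Uexplicit-elim 0<d U
... | r , s , s<b , refl , digits@(0<s , _) =
  ≤-trans 0<s (m≤n+m s (r * b)) ,
  subst (r * b + s <_) (cong (b *_) (sym (*-identityʳ b))) (digits-< (m+n≤o⇒m<o 0<s (UDigits⇒sum≤ digits)) s<b)

module _ {b k d : ℕ} .{{_ : NonZero b}} (1<b : 1 < b) (2<k : 2 < k) (0<d : 0 < d) (d<b : d < b) where

  private
    N = d * b ^ k
    D = lowerDigit b d

  b²≤N : b ^ 2 ≤ N
  b²≤N = ≤-trans (^-monoʳ-≤ b (<⇒≤ 2<k)) (m≤n*m (b ^ k) d {{>-nonZero 0<d}})

  msd-candidate : ∀ {a y} → N ≤ a + b ^ 2 → candidate b a y < N → msd b (candidate b a y) ≡ D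
  msd-candidate {a} {y} lo hi =
    msd-justBelow 1<b 2<k 0<d d<b (≤-trans lo (+-monoˡ-≤ (b ^ 2) (candidate-≥ b a y))) hi

  commaStep-stays : ∀ {a} → N ≤ a + b ^ 2 → candidate b a D < N → commaStep b a ≡ just (candidate b a D)
  commaStep-stays {a} lo hi = commaStep-first b (lowerDigit<b d<b) earlier (msd-candidate lo hi)
    where
    earlier : ∀ {z} → z < D → ¬ Qualifies b a z
    earlier {z} z<D qz = <⇒≢ z<D (trans (sym qz)
      (msd-candidate lo (≤-<-trans (+-monoʳ-≤ (a + b * (a % b)) (<⇒≤ z<D)) hi)))

  commaStep-leaves : ∀ {a c} → N ≤ a + b ^ 2 → N ≤ candidate b a D → commaStep b a ≡ just c → N ≤ c
  commaStep-leaves {a} lo N≤cD st with commaStep-sound b st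
  ... | y , qy , refl with N ≤? candidate b a y
  ...   | yes N≤c = N≤c
  ...   | no  N≰c = contradiction N≤cD (subst (λ z → N ≰ candidate b a z) y≡D N≰c)
    where
    y≡D : y ≡ D
    y≡D = trans (sym qy) (msd-candidate lo (≰⇒> N≰c))

  leaves⇔Uexplicit : ∀ {a} → a < N → N ≤ candidate b a D ⇔ Uexplicit b d (N ∸ a)
  leaves⇔Uexplicit {a} a<N = ⇔-sym (Uexplicit⇔exitBound 0<d d<b (m%n<n a b) (m<n⇒0<n∸m a<N) lastDigits)
                             ⇔-∘ mk⇔ (m≤n+o⇒m∸n≤o N a ∘ subst (N ≤_) (+-assoc a _ D)) toCandidate
    where
    a+u≡N : a + (N ∸ a) ≡ N
    a+u≡N = m+[n∸m]≡n (<⇒≤ a<N)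
    lastDigits : a % b + (N ∸ a) % b ≡ 0 ⊎ a % b + (N ∸ a) % b ≡ b
    lastDigits = lastDigits-complement a (N ∸ a) (subst (b ∣_) (sym a+u≡N) (n∣m*n^o d b k (<-trans z<s 2<k)))
    toCandidate : N ∸ a ≤ b * (a % b) + D → N ≤ candidate b a D
    toCandidate bound = subst (N ≤_) (sym (+-assoc a (b * (a % b)) D))
                          (subst (_≤ a + (b * (a % b) + D)) a+u≡N (+-monoʳ-≤ a bound))

  NoTermInIntervalAfter : ℕ → ℕ → Set
  NoTermInIntervalAfter v n = ∀ m a′ → n < m → comma b v m ≡ just a′ → ¬ InInterval b k d a′

  Uexplicit⇒noTermInIntervalAfter : ∀ {v n a} → comma b v n ≡ just a → InInterval b k d a →
                                    Uexplicit b d (N ∸ a) → NoTermInIntervalAfter v n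
  Uexplicit⇒noTermInIntervalAfter eq (lo , a<N) U m a′ n<m eqm (_ , a′<N)
    with comma-successor-≤-later b eq n<m eqm
  ... | c , st , c≤a′ =
    <⇒≱ a′<N (≤-trans (commaStep-leaves lo (Equivalence.from (leaves⇔Uexplicit a<N) U) st) c≤a′)

  lastTermInInterval : ∀ {v n a} → comma b v n ≡ just a → InInterval b k d a → Acc _<_ (N ∸ a) →
    ∃₂ λ n′ a′ → comma b v n′ ≡ just a′ × InInterval b k d a′ × NoTermInIntervalAfter v n′ ×
                 ∃ λ u → Uexplicit b d u × a′ + u ≡ N
  lastTermInInterval {v} {n} {a} eq (lo , a<N) (acc rec) with N ≤? candidate b a D
  ... | yes leaves = n , a , eq , (lo , a<N) , Uexplicit⇒noTermInIntervalAfter {n = n} eq (lo , a<N) U ,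
                     N ∸ a , U , m+[n∸m]≡n (<⇒≤ a<N)
    where
    U : Uexplicit b d (N ∸ a)
    U = Equivalence.to (leaves⇔Uexplicit a<N) leaves
  ... | no stays = lastTermInInterval {n = suc n} eq′ (lo′ , a′<N) (rec (∸-monoʳ-< a<a′ (<⇒≤ a′<N)))
    where
    a′<N : candidate b a D < N
    a′<N = ≰⇒> stays
    eq′ : comma b v (suc n) ≡ just (candidate b a D)
    eq′ rewrite eq = commaStep-stays lo a′<N
    lo′ : N ≤ candidate b a D + b ^ 2
    lo′ = ≤-trans lo (+-monoˡ-≤ (b ^ 2) (candidate-≥ b a D))
    a<a′ : a < candidate b a D
    a<a′ = <-≤-trans (m<m+n a (lowerDigit>0 d 1<b)) (+-monoˡ-≤ D (m≤m+n a (b * (a % b))))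

  Uexplicit-hasProperty : HasProperty b k d (Uexplicit b d)
  Uexplicit-hasProperty v _ (n , a , eq , a∈I) = lastTermInInterval {n = n} eq a∈I (<-wellFounded _)

  Uexplicit-<N : ∀ {u} → Uexplicit b d u → u < N
  Uexplicit-<N Uu = <-≤-trans (proj₂ (Uexplicit-bounds 0<d Uu)) b²≤N

  Uexplicit⇒complement∈interval : ∀ {u} → Uexplicit b d u → InInterval b k d (N ∸ u)
  Uexplicit⇒complement∈interval {u} Uu with Uexplicit-bounds 0<d Uu
  ... | 0<u , u<b² = subst (_≤ (N ∸ u) + b ^ 2) v+u≡N (+-monoʳ-≤ (N ∸ u) (<⇒≤ u<b²)) ,
                     subst (N ∸ u <_) v+u≡N (m<m+n (N ∸ u) 0<u)
    where
    v+u≡N : N ∸ u + u ≡ N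
    v+u≡N = m∸n+n≡m (<⇒≤ (Uexplicit-<N Uu))

  Uexplicit-minimal : ∀ (U : ℕ → Set) → HasProperty b k d U → ∀ u → Uexplicit b d u → U u
  Uexplicit-minimal U hasProperty u Uu
    with hasProperty (N ∸ u) (m<n⇒0<n∸m (Uexplicit-<N Uu)) (0 , N ∸ u , refl , Uexplicit⇒complement∈interval Uu)
  ... | zero , _ , refl , _ , _ , u′ , Uu′ , v+u′≡N =
    subst U (+-cancelˡ-≡ (N ∸ u) u′ u (trans v+u′≡N (sym (m∸n+n≡m (<⇒≤ (Uexplicit-<N Uu)))))) Uu′
  ... | suc n , a , eq , a∈I , _ =
    contradiction a∈I
      (Uexplicit⇒noTermInIntervalAfter {n = 0} refl (Uexplicit⇒complement∈interval Uu) exits (suc n) a z<s eq)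
    where
    exits : Uexplicit b d (N ∸ (N ∸ u))
    exits = subst (Uexplicit b d) (sym (m∸[m∸n]≡n (<⇒≤ (Uexplicit-<N Uu)))) Uu

mainTheorem3 : (b k d : ℕ) → .{{_ : NonZero b}} → 2 < b → 2 < k → 1 ≤ d → d < b →
    HasProperty b k d (Uexplicit b d) ×
    (∀ (U : ℕ → Set) → HasProperty b k d U → ∀ u → Uexplicit b d u → U u)
mainTheorem3 b k d 2<b 2<k 1≤d d<b =
  Uexplicit-hasProperty (<⇒≤ 2<b) 2<k 1≤d d<b , Uexplicit-minimal (<⇒≤ 2<b) 2<k 1≤d d<b
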